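{- Let $p$ be a prime, $\mathbb F=\mathbb F_p$, and let $\mathfrak X$ be a ternary coherent configuration on $\mathbb F$ invariant with respect to $\mathrm{AGL}_1(\mathbb F)$. For a class $\mathsf X\in\mathfrak X$ let $\mathsf X_{(0,1)}=\{z\in\mathbb F:(0,1,z)\in\mathsf X\}$, let $\mathfrak X_{(0,1)}=\{\mathsf X_{(0,1)}:\mathsf X\in\mathfrak X,\ \mathsf X_{(0,1)}\neq\varnothing\}$ (a partition of $\mathbb F$ having $\{0\}$ and $\{1\}$ as classes), and let $\Pi=\{X\in\mathfrak X_{(0,1)}:X\neq\{0\}\}$, a partition of $\mathbb F^\times$. Then $\Pi$ is a Schur partition of the multiplicative group $\mathbb F^\times$. Moreover, if $X\in\Pi$ and $1\notin X$, then $1-X=\{1-x:x\in X\}\in\Pi$.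
   Context: Ternary coherent configuration: for a finite set $\Omega$ and $M=\{1,2,3\}$, a partition $\mathfrak X$ of $\Omega^3$ such that for every class $X$: (C1) the equivalence relation $\rho(x)$ on $M$ ($i\sim j$ iff $x_i=x_j$) is the same for all $x\in X$; (C2) $X^\sigma=\{(x_{1^\sigma},x_{2^\sigma},x_{3^\sigma}):x\in X\}\in\mathfrak X$ for every map $\sigma:M\to M$; (C3) for any classes $X_1,X_2,X_3$ the number of $\alpha\in\Omega$ such that the triple obtained from $x$ by replacing its $i$th coordinate with $\alpha$ lies in $X_i$ for all $i$, is independent of $x\in X$. Invariance with respect to $H\le\mathrm{Sym}(\Omega)$ means $X^f=X$ for all classes $X$ and $f\in H$ (componentwise action). $\mathrm{AGL}_1(\mathbb F)$ is the group of maps $x\mapsto ax+b$, $a\in\mathbb F^\times,b\in\mathbb F$. A partition $\Pi$ of a group $G$ is a Schur partition if $\{1\}\in\Pi$, $X^{ -1}=\{x^{ -1}:x\in X\}\in\Pi$ for all $X\in\Pi$, and the $\mathbb Z$-span of the elements $\underline X=\sum_{x\in X}x\in\mathbb ZG$, $X\in\Pi$, is a subring of the group ring $\mathbb ZG$. -}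

module Defs where

open import Data.Nat as ℕ using (ℕ; zero; suc; _∸_; _≡ᵇ_)
open import Data.Nat.DivMod using (_mod_)
open import Data.Fin using (Fin; zero; suc; toℕ; _≟_)
open import Data.Integer as ℤ using (ℤ)
open import Data.Bool using (Bool; true; false; _∧_; _∨_; if_then_else_; not)
open import Data.Product using (_×_; _,_; proj₁; proj₂; Σ; ∃; ∃-syntax)
open import Data.List using (List; []; _∷_)
open import Data.List.Relation.Unary.All using (All)
open import Relation.Nullary using (¬_; does)
open import Relation.Binary.PropositionalEquality using (_≡_; _≢_)

ΣFin : ∀ m → (Fin m → ℤ) → ℤ
ΣFin zero    f = ℤ.0ℤ
ΣFin (suc m) f = f zero ℤ.+ ΣFin m (λ i → f (suc i))

count : ∀ m → (Fin m → Bool) → ℕ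
count zero    P = 0
count (suc m) P = (if P zero then 1 else 0) ℕ.+ count m (λ i → P (suc i))

anyFin : ∀ m → (Fin m → Bool) → Bool
anyFin zero    P = false
anyFin (suc m) P = P zero ∨ anyFin m (λ i → P (suc i))

-- The prime field F_p, p = n + 2, realised as Fin p with arithmetic mod p

module Field (n : ℕ) where

  p : ℕ
  p = suc (suc n)

  F : Set
  F = Fin p

  0F 1F : F
  0F = zero
  1F = suc zero

  _==_ : F → F → Bool
  a == b = does (a ≟ b)

  _+F_ _*F_ _-F_ : F → F → F
  a +F b = (toℕ a ℕ.+ toℕ b) mod p
  a *F b = (toℕ a ℕ.* toℕ b) mod p
  a -F b = (toℕ a ℕ.+ (p ∸ toℕ b)) mod p

  -- Triples in F³ and the maps σ : M → M acting on them, M = {1,2,3} = Fin 3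

  Tri : Set
  Tri = F × F × F

  coord : Tri → Fin 3 → F
  coord (a , b , c) zero             = a
  coord (a , b , c) (suc zero)       = b
  coord (a , b , c) (suc (suc zero)) = c

  act : (Fin 3 → Fin 3) → Tri → Tri
  act σ x = coord x (σ zero) , coord x (σ (suc zero)) , coord x (σ (suc (suc zero)))

  upd : Tri → Fin 3 → F → Tri
  upd (a , b , c) zero             α = α , b , c
  upd (a , b , c) (suc zero)       α = a , α , c
  upd (a , b , c) (suc (suc zero)) α = a , b , α

  mapTri : (F → F) → Tri → Tri
  mapTri f (a , b , c) = f a , f b , f c

  -- A partition 𝔛 of F³ is given by a colouring col : F³ → ℕ; its classes are
  -- the (nonempty) fibres of col.  Ternary coherent configuration:

  record IsTernaryCC (col : Tri → ℕ) : Set where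
    field
      -- (C1) ρ(x) is constant on each class
      C1 : ∀ x y → col x ≡ col y → ∀ i j → coord x i ≡ coord x j → coord y i ≡ coord y j
      -- (C2) X^σ is a class: it lies inside one class ...
      C2-⊆ : ∀ (σ : Fin 3 → Fin 3) x y → col x ≡ col y → col (act σ x) ≡ col (act σ y)
      -- ... and exhausts that class
      C2-⊇ : ∀ (σ : Fin 3 → Fin 3) x z → col z ≡ col (act σ x) →
             ∃[ y ] (col y ≡ col x × act σ y ≡ z)
      -- (C3) intersection numbers (classes X₁,X₂,X₃ given by colours c₁,c₂,c₃)
      C3 : ∀ (c₁ c₂ c₃ : ℕ) x y → col x ≡ col y →
           count p (λ α → (col (upd x zero α) ≡ᵇ c₁) ∧ (col (upd x (suc zero) α) ≡ᵇ c₂)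
                          ∧ (col (upd x (suc (suc zero)) α) ≡ᵇ c₃))
           ≡ count p (λ α → (col (upd y zero α) ≡ᵇ c₁) ∧ (col (upd y (suc zero) α) ≡ᵇ c₂)
                          ∧ (col (upd y (suc (suc zero)) α) ≡ᵇ c₃))

  AGL-Invariant : (Tri → ℕ) → Set
  AGL-Invariant col = ∀ (a b : F) → a ≢ 0F → ∀ x → col (mapTri (λ t → (a *F t) +F b) x) ≡ col x

  Subset : Set
  Subset = F → Bool

  _≐_ : Subset → Subset → Set
  S ≐ T = ∀ w → S w ≡ T w

  singleton : F → Subset
  singleton a w = w == a

  inverseSet : Subset → Subset
  inverseSet S w = anyFin p (λ x → S x ∧ ((x *F w) == 1F))

  oneMinus : Subset → Subset
  oneMinus S w = anyFin p (λ x → S x ∧ (w == (1F -F x)))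

  module _ (col : Tri → ℕ) where

    -- the class of 𝔛_(0,1) containing z, i.e. 𝖷_(0,1) for the class 𝖷 ∋ (0,1,z)
    fibre01 : F → Subset
    fibre01 z w = col (0F , 1F , w) ≡ᵇ col (0F , 1F , z)

    -- S ∈ 𝔛_(0,1)  (nonempty 𝖷_(0,1) are exactly the fibres of z ↦ col(0,1,z))
    In𝔛01 : Subset → Set
    In𝔛01 S = ∃[ z ] (S ≐ fibre01 z)

    InΠ : Subset → Set
    InΠ S = In𝔛01 S × ¬ (S ≐ singleton 0F)

  -- Partitions of F^× and Schur partitions of the group F^×.
  -- A family of subsets is given by a membership predicate Fam on Subset
  -- (closed under ≐ in our use).

  IsPartitionOfUnits : (Subset → Set) → Set
  IsPartitionOfUnits Fam =
      (∀ S → Fam S → ∀ w → S w ≡ true → w ≢ 0F)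
    × (∀ S → Fam S → ∃[ w ] (S w ≡ true))
    × (∀ w → w ≢ 0F → ∃[ S ] (Fam S × S w ≡ true))
    × (∀ S T w → Fam S → Fam T → S w ≡ true → T w ≡ true → S ≐ T)

  -- Group ring ℤ[F^×]: functions F → ℤ, only their values on F^× matter.
  ZG : Set
  ZG = F → ℤ

  _≈G_ : ZG → ZG → Set
  f ≈G g = ∀ z → z ≢ 0F → f z ≡ g z

  _+G_ : ZG → ZG → ZG
  (f +G g) z = f z ℤ.+ g z

  -G_ : ZG → ZG
  (-G f) z = ℤ.- f z

  _*G_ : ZG → ZG → ZG
  (f *G g) z = ΣFin p (λ x → ΣFin p (λ y →
                 if not (x == 0F) ∧ not (y == 0F) ∧ ((x *F y) == z)
                 then f x ℤ.* g y else ℤ.0ℤ))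

  oneG : ZG
  oneG z = if z == 1F then ℤ.1ℤ else ℤ.0ℤ

  classSum : Subset → ZG
  classSum S z = if S z then ℤ.1ℤ else ℤ.0ℤ

  linComb : List (Subset × ℤ) → ZG
  linComb []            z = ℤ.0ℤ
  linComb ((S , c) ∷ L) z = (c ℤ.* classSum S z) ℤ.+ linComb L z

  InSpan : (Subset → Set) → ZG → Set
  InSpan Fam h = ∃[ L ] (All (λ Sc → Fam (proj₁ Sc)) L × h ≈G linComb L)

  SpanIsSubring : (Subset → Set) → Set
  SpanIsSubring Fam =
      InSpan Fam oneG
    × (∀ f g → InSpan Fam f → InSpan Fam g → InSpan Fam (f +G g))
    × (∀ f → InSpan Fam f → InSpan Fam (-G f))
    × (∀ f g → InSpan Fam f → InSpan Fam g → InSpan Fam (f *G g))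

  IsSchurPartition : (Subset → Set) → Set
  IsSchurPartition Fam =
      IsPartitionOfUnits Fam
    × Fam (singleton 1F)
    × (∀ X → Fam X → Fam (inverseSet X))
    × SpanIsSubring Fam

module Submission where

-- Let κ v be the colour of (0, 1, v): the classes of 𝔛_(0,1) are the fibres of κ, and (C1) makes
-- {0} and {1} fibres. Invariance under x ↦ a x gives col (0, a, z) = κ (z / a), so permuting the
-- coordinates by (2 3) sends the fibre of u to that of u⁻¹, and x ↦ 1 − x followed by (1 2) sends
-- it to the fibre of 1 − u. A function on F^× lies in the span of the class sums exactly when it is
-- constant on fibres. The coefficient of z in X̲ Y̲ counts the α ∈ X such that (0, α, z) has the
-- colour of Y; summing the intersection numbers (C3) at (0, 1, z) over the colour of (α, 1, z)
-- shows that it depends only on κ z, and bilinearity extends this to the whole span.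

open import Defs
open import Data.Nat using (ℕ)
open import Data.Nat.Primality using (Prime)
open import Data.Bool using (false)
open import Data.Product using (_×_)
open import Relation.Binary.PropositionalEquality using (_≡_)

open import Algebra.Definitions using (Involutive)
open import Data.Bool using (Bool; true; not; _∧_; _∨_; if_then_else_)
open import Data.Bool.Properties using (∧-comm; ∧-zeroʳ; ∧-identityʳ; ∨-identityʳ; ¬-not; not-¬)
open import Data.Empty using (⊥-elim)
open import Data.Fin as Fin using (Fin; zero; suc; toℕ; fromℕ<; punchIn; _≟_; _<?_)
open import Data.Fin.Properties
  using (toℕ-injective; toℕ-fromℕ<; toℕ<n; toℕ-inject; suc-injective; punchInᵢ≢i; <-cmp; ¬∀⟶∃¬-smallest)
open import Data.Integer as ℤ using (ℤ; 0ℤ; 1ℤ; _+_; _*_; -_)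
import Data.Integer.Properties as ℤP
open import Algebra.Properties.Semiring.Sum ℤP.+-*-semiring
  using (sum; sum-syntax; sum-cong-≗; sum-remove; sum-replicate-zero; ∑-comm; ∑-distrib-+; *-distribˡ-sum)
open import Data.List using ([]; _∷_; tabulate)
open import Data.List.Relation.Unary.All using (All; []; _∷_)
open import Data.List.Relation.Unary.All.Properties using (tabulate⁺)
open import Data.Nat as ℕ using (_≡ᵇ_; _%_)
import Data.Nat.Properties as ℕ
open import Data.Nat.DivMod using (_mod_; m%n<n; m<n⇒m%n≡m; %-distribˡ-+; %-distribˡ-*; [m+kn]%n≡m%n; n%n≡0)
open import Data.Nat.Coprimality using (prime⇒coprime; coprime-Bézout)
open import Data.Nat.GCD using (module Bézout)
open import Data.Nat.Tactic.RingSolver using (solve-∀)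
open import Data.Product using (_,_; proj₁; proj₂; ∃-syntax)
open import Function using (_∘_; mk⇔)
open import Relation.Binary using (tri<; tri≈; tri>)
open import Relation.Binary.PropositionalEquality
  using (_≢_; refl; sym; trans; cong; cong₂; subst; module ≡-Reasoning)
open import Relation.Nullary using (Dec; yes; no; does; ¬?; _×-dec_)
open import Relation.Nullary.Decidable using (dec-true; dec-false; does-⇔; decidable-stable)

open ≡-Reasoning

ind : Bool → ℤ
ind b = if b then 1ℤ else 0ℤ

dec-witness : ∀ {a} {A : Set a} (a? : Dec A) → does a? ≡ true → A
dec-witness (yes a) _ = a
dec-witness (no  _) ()

ind-∧ : ∀ a b → ind a * ind b ≡ ind (a ∧ b)
ind-∧ true  b = ℤP.*-identityˡ (ind b)
ind-∧ false b = refl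

ind-cong : ∀ b {x y : ℤ} → (b ≡ true → x ≡ y) → x * ind b ≡ y * ind b
ind-cong true          x≡y = cong (_* 1ℤ) (x≡y refl)
ind-cong false {x} {y} _   = trans (ℤP.*-zeroʳ x) (sym (ℤP.*-zeroʳ y))

∧-congˡ-if : ∀ {a a'} b → (b ≡ true → a ≡ a') → a ∧ b ≡ a' ∧ b
∧-congˡ-if           true  a≡a' = cong (_∧ true) (a≡a' refl)
∧-congˡ-if {a} {a'} false _    = trans (∧-zeroʳ a) (sym (∧-zeroʳ a'))

anyFin-intro : ∀ {m} (P : Fin m → Bool) i → P i ≡ true → anyFin m P ≡ true
anyFin-intro P zero    Pi rewrite Pi = refl
anyFin-intro P (suc i) Pi with P zero
... | true  = refl
... | false = anyFin-intro (P ∘ suc) i Pi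

anyFin-false : ∀ {m} (P : Fin m → Bool) → (∀ i → P i ≡ false) → anyFin m P ≡ false
anyFin-false {ℕ.zero}  P _   = refl
anyFin-false {ℕ.suc m} P all rewrite all zero = anyFin-false (P ∘ suc) (all ∘ suc)

anyFin-single : ∀ {m} (P : Fin m → Bool) j → (∀ i → i ≢ j → P i ≡ false) → anyFin m P ≡ P j
anyFin-single P zero    off =
  trans (cong (P zero ∨_) (anyFin-false (P ∘ suc) (λ i → off (suc i) λ ()))) (∨-identityʳ (P zero))
anyFin-single P (suc j) off rewrite off zero (λ ()) =
  anyFin-single (P ∘ suc) j (λ i i≢j → off (suc i) (i≢j ∘ suc-injective))

anyFin-∧-unique : ∀ {m} (P R : Fin m → Bool) j → R j ≡ true → (∀ i → R i ≡ true → i ≡ j) →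
                  anyFin m (λ i → P i ∧ R i) ≡ P j
anyFin-∧-unique P R j Rj unique = begin
  anyFin _ (λ i → P i ∧ R i)  ≡⟨ anyFin-single _ j (λ i i≢j →
                                   trans (cong (P i ∧_) (¬-not (i≢j ∘ unique i))) (∧-zeroʳ (P i))) ⟩
  P j ∧ R j                   ≡⟨ cong (P j ∧_) Rj ⟩
  P j ∧ true                  ≡⟨ ∧-identityʳ (P j) ⟩
  P j                         ∎

ΣFin≡sum : ∀ m (f : Fin m → ℤ) → ΣFin m f ≡ sum f
ΣFin≡sum ℕ.zero    f = refl
ΣFin≡sum (ℕ.suc m) f = cong (f zero +_) (ΣFin≡sum m (f ∘ suc))

count≡sum : ∀ m (P : Fin m → Bool) → ℤ.+ count m P ≡ ∑[ i < m ] ind (P i)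
count≡sum ℕ.zero    P = refl
count≡sum (ℕ.suc m) P with P zero
... | true  = trans (ℤP.pos-+ 1 (count m (P ∘ suc))) (cong (1ℤ +_) (count≡sum m (P ∘ suc)))
... | false = trans (count≡sum m (P ∘ suc)) (sym (ℤP.+-identityˡ _))

∑-linear : ∀ {m} c (f g : Fin m → ℤ) → ∑[ i < m ] (c * f i + g i) ≡ c * sum f + sum g
∑-linear c f g = trans (∑-distrib-+ (λ i → c * f i) g) (cong (_+ sum g) (sym (*-distribˡ-sum c f)))

sum-single : ∀ {m} (f : Fin m → ℤ) j → (∀ i → i ≢ j → f i ≡ 0ℤ) → sum f ≡ f j
sum-single {ℕ.suc m} f j off = begin
  sum f                      ≡⟨ sum-remove {i = j} f ⟩
  f j + sum (f ∘ punchIn j)  ≡⟨ cong (f j +_) (trans (sum-cong-≗ (λ k → off _ (punchInᵢ≢i j k))) (sum-replicate-zero m)) ⟩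
  f j + 0ℤ                   ≡⟨ ℤP.+-identityʳ (f j) ⟩
  f j                        ∎

bounded : ∀ {m} (f : Fin m → ℕ) → ∃[ N ] (∀ i → f i ℕ.< N)
bounded {ℕ.zero}  f = 0 , λ ()
bounded {ℕ.suc m} f with bounded (f ∘ suc)
... | N , f<N = ℕ.suc (f zero) ℕ.⊔ N , λ
  { zero    → ℕ.m≤m⊔n (ℕ.suc (f zero)) N
  ; (suc i) → ℕ.<-≤-trans (f<N i) (ℕ.m≤n⊔m (ℕ.suc (f zero)) N)
  }

count-by-colour : ∀ {m N} (f : Fin m → ℕ) (P : Fin m → Bool) → (∀ i → f i ℕ.< N) →
                  ∑[ c < N ] (ℤ.+ count m (λ i → (f i ≡ᵇ toℕ c) ∧ P i)) ≡ ℤ.+ count m P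
count-by-colour {m} {N} f P f<N = begin
  ∑[ c < N ] (ℤ.+ count m (λ i → (f i ≡ᵇ toℕ c) ∧ P i))  ≡⟨ sum-cong-≗ {N} (λ c → count≡sum m (λ i → (f i ≡ᵇ toℕ c) ∧ P i)) ⟩
  ∑[ c < N ] ∑[ i < m ] ind ((f i ≡ᵇ toℕ c) ∧ P i)       ≡⟨ ∑-comm {N} {m} (λ c i → ind ((f i ≡ᵇ toℕ c) ∧ P i)) ⟩
  ∑[ i < m ] ∑[ c < N ] ind ((f i ≡ᵇ toℕ c) ∧ P i)       ≡⟨ sum-cong-≗ (λ i → sum-single _ (colour i) (off i)) ⟩
  ∑[ i < m ] ind ((f i ≡ᵇ toℕ (colour i)) ∧ P i)         ≡⟨ sum-cong-≗ (λ i → cong (λ b → ind (b ∧ P i)) (on i)) ⟩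
  ∑[ i < m ] ind (P i)                                   ≡⟨ count≡sum m P ⟨
  ℤ.+ count m P                                          ∎
  where
  colour : Fin m → Fin N
  colour i = fromℕ< (f<N i)
  on : ∀ i → (f i ≡ᵇ toℕ (colour i)) ≡ true
  on i = dec-true (f i ℕ.≟ _) (sym (toℕ-fromℕ< (f<N i)))
  off : ∀ i c → c ≢ colour i → ind ((f i ≡ᵇ toℕ c) ∧ P i) ≡ 0ℤ
  off i c c≢ = cong (λ b → ind (b ∧ P i))
    (dec-false (f i ℕ.≟ _) (λ e → c≢ (toℕ-injective (trans (sym e) (sym (toℕ-fromℕ< (f<N i)))))))

first-in-fibre : ∀ {m} (κ : Fin m → ℕ) z → ∃[ w ] (κ w ≡ κ z × ∀ {v} → v Fin.< w → κ v ≢ κ z)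
first-in-fibre {m} κ z with ¬∀⟶∃¬-smallest m (λ v → κ v ≢ κ z) (λ v → ¬? (κ v ℕ.≟ κ z)) (λ all≢ → all≢ z refl)
... | w , ¬κw≢κz , below = w , decidable-stable (κ w ℕ.≟ κ z) ¬κw≢κz , λ v<w →
  subst (λ v → κ v ≢ κ z) (toℕ-injective (trans (toℕ-inject (fromℕ< v<w)) (toℕ-fromℕ< v<w))) (below (fromℕ< v<w))

isFirst : ∀ {m} → (Fin m → ℕ) → Fin m → Bool
isFirst {m} κ w = not (anyFin m (λ v → does (v <? w) ∧ (κ v ≡ᵇ κ w)))

unique-first-in-fibre : ∀ {m} (κ : Fin m → ℕ) z → ∑[ w < m ] ind (isFirst κ w ∧ (κ z ≡ᵇ κ w)) ≡ 1ℤ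
unique-first-in-fibre {m} κ z with first-in-fibre κ z
... | w₀ , κw₀≡κz , below =
  trans (sum-single _ w₀ (λ w w≢w₀ → cong ind (elsewhere w w≢w₀ (κ z ℕ.≟ κ w)))) (cong ind at-w₀)
  where
  none-earlier : ∀ v → (v<w₀? : Dec (v Fin.< w₀)) → does v<w₀? ∧ (κ v ≡ᵇ κ w₀) ≡ false
  none-earlier v (yes v<w₀) = dec-false (κ v ℕ.≟ κ w₀) (λ e → below v<w₀ (trans e κw₀≡κz))
  none-earlier v (no  _)    = refl
  at-w₀ : isFirst κ w₀ ∧ (κ z ≡ᵇ κ w₀) ≡ true
  at-w₀ = cong₂ _∧_ (cong not (anyFin-false _ (λ v → none-earlier v (v <? w₀)))) (dec-true (κ z ℕ.≟ κ w₀) (sym κw₀≡κz))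
  elsewhere : ∀ w → w ≢ w₀ → Dec (κ z ≡ κ w) → isFirst κ w ∧ (κ z ≡ᵇ κ w) ≡ false
  elsewhere w _ (no κz≢κw) = trans (cong (isFirst κ w ∧_) (dec-false (κ z ℕ.≟ κ w) κz≢κw)) (∧-zeroʳ _)
  elsewhere w w≢w₀ (yes κz≡κw) with <-cmp w w₀
  ... | tri< w<w₀ _ _ = ⊥-elim (below w<w₀ (sym κz≡κw))
  ... | tri≈ _ w≡w₀ _ = ⊥-elim (w≢w₀ w≡w₀)
  ... | tri> _ _ w₀<w = cong (λ b → not b ∧ (κ z ≡ᵇ κ w))
    (anyFin-intro _ w₀ (cong₂ _∧_ (dec-true (w₀ <? w) w₀<w) (dec-true (κ w₀ ℕ.≟ κ w) (trans κw₀≡κz κz≡κw))))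

fibre-expansion : ∀ {m} (κ : Fin m → ℕ) (h : Fin m → ℤ) z → (∀ {w} → κ w ≡ κ z → h w ≡ h z) →
                  h z ≡ ∑[ w < m ] ((h w * ind (isFirst κ w)) * ind (κ z ≡ᵇ κ w))
fibre-expansion {m} κ h z constant = begin
  h z                                                        ≡⟨ ℤP.*-identityʳ (h z) ⟨
  h z * 1ℤ                                                   ≡⟨ cong (h z *_) (unique-first-in-fibre κ z) ⟨
  h z * ∑[ w < m ] ind (first w ∧ same w)                    ≡⟨ *-distribˡ-sum (h z) (λ w → ind (first w ∧ same w)) ⟩
  ∑[ w < m ] (h z * ind (first w ∧ same w))                  ≡⟨ sum-cong-≗ term ⟩
  ∑[ w < m ] ((h w * ind (first w)) * ind (same w))          ∎
  where
  first same : Fin _ → Bool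
  first = isFirst κ
  same w = κ z ≡ᵇ κ w
  term : ∀ w → h z * ind (first w ∧ same w) ≡ (h w * ind (first w)) * ind (same w)
  term w = begin
    h z * ind (first w ∧ same w)           ≡⟨ cong (h z *_) (ind-∧ (first w) (same w)) ⟨
    h z * (ind (first w) * ind (same w))   ≡⟨ ℤP.*-assoc (h z) (ind (first w)) (ind (same w)) ⟨
    (h z * ind (first w)) * ind (same w)   ≡⟨ ind-cong (same w) {h z * ind (first w)}
                                                (λ z~w → cong (_* ind (first w)) (sym (constant (sym (dec-witness (κ z ℕ.≟ κ w) z~w))))) ⟩
    (h w * ind (first w)) * ind (same w)   ∎

module PrimeField (n : ℕ) where
  open Field n

  ι : ℕ → F
  ι m = m mod p

  toℕ-ι : ∀ m → toℕ (ι m) ≡ m % p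
  toℕ-ι m = toℕ-fromℕ< (m%n<n m p)

  ι-toℕ : ∀ a → ι (toℕ a) ≡ a
  ι-toℕ a = toℕ-injective (trans (toℕ-ι (toℕ a)) (m<n⇒m%n≡m (toℕ<n a)))

  ι-cong-% : ∀ m k → m % p ≡ k % p → ι m ≡ ι k
  ι-cong-% m k e = toℕ-injective (trans (toℕ-ι m) (trans e (sym (toℕ-ι k))))

  ι-+p : ∀ m k → ι (m ℕ.+ k ℕ.* p) ≡ ι m
  ι-+p m k = ι-cong-% (m ℕ.+ k ℕ.* p) m ([m+kn]%n≡m%n m k p)

  ι-+ : ∀ m k → ι m +F ι k ≡ ι (m ℕ.+ k)
  ι-+ m k = ι-cong-% (toℕ (ι m) ℕ.+ toℕ (ι k)) (m ℕ.+ k) (begin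
    (toℕ (ι m) ℕ.+ toℕ (ι k)) % p  ≡⟨ cong₂ (λ a b → (a ℕ.+ b) % p) (toℕ-ι m) (toℕ-ι k) ⟩
    (m % p ℕ.+ k % p) % p          ≡⟨ %-distribˡ-+ m k p ⟨
    (m ℕ.+ k) % p                  ∎)

  ι-* : ∀ m k → ι m *F ι k ≡ ι (m ℕ.* k)
  ι-* m k = ι-cong-% (toℕ (ι m) ℕ.* toℕ (ι k)) (m ℕ.* k) (begin
    (toℕ (ι m) ℕ.* toℕ (ι k)) % p  ≡⟨ cong₂ (λ a b → (a ℕ.* b) % p) (toℕ-ι m) (toℕ-ι k) ⟩
    (m % p ℕ.* (k % p)) % p        ≡⟨ %-distribˡ-* m k p ⟨
    (m ℕ.* k) % p                  ∎)

  *F-comm : ∀ a b → a *F b ≡ b *F a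
  *F-comm a b = cong ι (ℕ.*-comm (toℕ a) (toℕ b))

  *F-assoc : ∀ a b c → (a *F b) *F c ≡ a *F (b *F c)
  *F-assoc a b c = begin
    ι (A ℕ.* B) *F c          ≡⟨ cong (ι (A ℕ.* B) *F_) (ι-toℕ c) ⟨
    ι (A ℕ.* B) *F ι C        ≡⟨ ι-* (A ℕ.* B) C ⟩
    ι (A ℕ.* B ℕ.* C)         ≡⟨ cong ι (ℕ.*-assoc A B C) ⟩
    ι (A ℕ.* (B ℕ.* C))       ≡⟨ ι-* A (B ℕ.* C) ⟨
    ι A *F ι (B ℕ.* C)        ≡⟨ cong (_*F ι (B ℕ.* C)) (ι-toℕ a) ⟩
    a *F (b *F c)             ∎
    where
    A B C : ℕ
    A = toℕ a
    B = toℕ b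
    C = toℕ c

  *F-identityˡ : ∀ a → 1F *F a ≡ a
  *F-identityˡ a = trans (cong ι (ℕ.*-identityˡ (toℕ a))) (ι-toℕ a)

  *F-identityʳ : ∀ a → a *F 1F ≡ a
  *F-identityʳ a = trans (*F-comm a 1F) (*F-identityˡ a)

  *F-zeroʳ : ∀ a → a *F 0F ≡ 0F
  *F-zeroʳ a = cong ι (ℕ.*-zeroʳ (toℕ a))

  +F-identityʳ : ∀ a → a +F 0F ≡ a
  +F-identityʳ a = trans (cong ι (ℕ.+-identityʳ (toℕ a))) (ι-toℕ a)

  0F≢1F : 0F ≢ 1F
  0F≢1F ()

  -1F : F
  -1F = ι (ℕ.suc n)

  -1F≢0 : -1F ≢ 0F
  -1F≢0 e = ℕ.1+n≢0 (trans (sym (m<n⇒m%n≡m (ℕ.n<1+n (ℕ.suc n)))) (trans (sym (toℕ-ι (ℕ.suc n))) (cong toℕ e)))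

  reflect : F → F
  reflect t = (-1F *F t) +F 1F

  reflect-ι : ∀ m → reflect (ι m) ≡ ι (ℕ.suc n ℕ.* m ℕ.+ 1)
  reflect-ι m = trans (cong (_+F 1F) (ι-* (ℕ.suc n) m)) (ι-+ (ℕ.suc n ℕ.* m) 1)

  reflect-0 : reflect 0F ≡ 1F
  reflect-0 = trans (reflect-ι 0) (cong (λ k → ι (k ℕ.+ 1)) (ℕ.*-zeroʳ (ℕ.suc n)))

  reflect-1 : reflect 1F ≡ 0F
  reflect-1 = trans (reflect-ι 1) (ι-cong-% (ℕ.suc n ℕ.* 1 ℕ.+ 1) 0 (trans (cong (_% p) (lemma n)) (n%n≡0 p)))
    where
    lemma : ∀ n → ℕ.suc n ℕ.* 1 ℕ.+ 1 ≡ ℕ.suc (ℕ.suc n)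
    lemma = solve-∀

  reflect-involutive : Involutive _≡_ reflect
  reflect-involutive w = begin
    reflect (reflect w)                                   ≡⟨ cong (reflect ∘ reflect) (ι-toℕ w) ⟨
    reflect (reflect (ι W))                               ≡⟨ cong reflect (reflect-ι W) ⟩
    reflect (ι (ℕ.suc n ℕ.* W ℕ.+ 1))                     ≡⟨ reflect-ι (ℕ.suc n ℕ.* W ℕ.+ 1) ⟩
    ι (ℕ.suc n ℕ.* (ℕ.suc n ℕ.* W ℕ.+ 1) ℕ.+ 1)           ≡⟨ cong ι (lemma n W) ⟩
    ι (W ℕ.+ (n ℕ.* W ℕ.+ 1) ℕ.* p)                       ≡⟨ ι-+p W (n ℕ.* W ℕ.+ 1) ⟩
    ι W                                                   ≡⟨ ι-toℕ w ⟩
    w                                                     ∎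
    where
    W : ℕ
    W = toℕ w
    lemma : ∀ n W → ℕ.suc n ℕ.* (ℕ.suc n ℕ.* W ℕ.+ 1) ℕ.+ 1 ≡ W ℕ.+ (n ℕ.* W ℕ.+ 1) ℕ.* ℕ.suc (ℕ.suc n)
    lemma = solve-∀

  -- 1F -F t is ι (1 + (p ∸ T)); adding p = T + (p ∸ T) turns the congruence into a semiring identity.
  reflect≡1- : ∀ t → reflect t ≡ 1F -F t
  reflect≡1- t = trans (cong reflect (sym (ι-toℕ t))) (trans (reflect-ι T) (ι-cong-% (ℕ.suc n ℕ.* T ℕ.+ 1) (1 ℕ.+ D) (begin
    (ℕ.suc n ℕ.* T ℕ.+ 1) % p                           ≡⟨ [m+kn]%n≡m%n (ℕ.suc n ℕ.* T ℕ.+ 1) 1 p ⟨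
    (ℕ.suc n ℕ.* T ℕ.+ 1 ℕ.+ 1 ℕ.* p) % p               ≡⟨ cong (λ q → (ℕ.suc n ℕ.* T ℕ.+ 1 ℕ.+ 1 ℕ.* q) % p) T+D≡p ⟨
    (ℕ.suc n ℕ.* T ℕ.+ 1 ℕ.+ 1 ℕ.* (T ℕ.+ D)) % p       ≡⟨ cong (_% p) (lemma n T D) ⟩
    (1 ℕ.+ D ℕ.+ T ℕ.* p) % p                           ≡⟨ [m+kn]%n≡m%n (1 ℕ.+ D) T p ⟩
    (1 ℕ.+ D) % p                                       ∎)))
    where
    T D : ℕ
    T = toℕ t
    D = p ℕ.∸ T
    T+D≡p : T ℕ.+ D ≡ p
    T+D≡p = ℕ.m+[n∸m]≡n (ℕ.<⇒≤ (toℕ<n t))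
    lemma : ∀ n T D → ℕ.suc n ℕ.* T ℕ.+ 1 ℕ.+ 1 ℕ.* (T ℕ.+ D) ≡ 1 ℕ.+ D ℕ.+ T ℕ.* ℕ.suc (ℕ.suc n)
    lemma = solve-∀

  module Inverse (p-prime : Prime p) where

    inverse-exists : ∀ {a} → a ≢ 0F → ∃[ b ] (b *F a ≡ 1F)
    -- Bézout for p and A = toℕ a: either y A = 1 + x p and y inverts a, or y A + 1 = x p and (p − 1) y does.
    inverse-exists {a} a≢0 with coprime-Bézout (prime⇒coprime p-prime {{ℕ.≢-nonZero (a≢0 ∘ toℕ-injective)}} (toℕ<n a))
    ... | Bézout.-+ x y eq = ι y , (begin
      ι y *F a                 ≡⟨ cong (ι y *F_) (ι-toℕ a) ⟨
      ι y *F ι (toℕ a)         ≡⟨ ι-* y (toℕ a) ⟩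
      ι (y ℕ.* toℕ a)          ≡⟨ cong ι eq ⟨
      ι (1 ℕ.+ x ℕ.* p)        ≡⟨ ι-+p 1 x ⟩
      1F                       ∎)
    ... | Bézout.+- x y eq = ι (ℕ.suc n ℕ.* y) , (begin
      ι (ℕ.suc n ℕ.* y) *F a                       ≡⟨ cong (ι (ℕ.suc n ℕ.* y) *F_) (ι-toℕ a) ⟨
      ι (ℕ.suc n ℕ.* y) *F ι A                     ≡⟨ ι-* (ℕ.suc n ℕ.* y) A ⟩
      ι (ℕ.suc n ℕ.* y ℕ.* A)                      ≡⟨ ι-+p (ℕ.suc n ℕ.* y ℕ.* A) 1 ⟨
      ι (ℕ.suc n ℕ.* y ℕ.* A ℕ.+ 1 ℕ.* p)          ≡⟨ cong ι (lemma₁ n y A) ⟩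
      ι (ℕ.suc n ℕ.* (1 ℕ.+ y ℕ.* A) ℕ.+ 1)        ≡⟨ cong (λ q → ι (ℕ.suc n ℕ.* q ℕ.+ 1)) eq ⟩
      ι (ℕ.suc n ℕ.* (x ℕ.* p) ℕ.+ 1)              ≡⟨ cong ι (lemma₂ n x) ⟩
      ι (1 ℕ.+ ℕ.suc n ℕ.* x ℕ.* p)                ≡⟨ ι-+p 1 (ℕ.suc n ℕ.* x) ⟩
      1F                                           ∎)
      where
      A : ℕ
      A = toℕ a
      lemma₁ : ∀ n y A → ℕ.suc n ℕ.* y ℕ.* A ℕ.+ 1 ℕ.* ℕ.suc (ℕ.suc n) ≡ ℕ.suc n ℕ.* (1 ℕ.+ y ℕ.* A) ℕ.+ 1
      lemma₁ = solve-∀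
      lemma₂ : ∀ n x → ℕ.suc n ℕ.* (x ℕ.* ℕ.suc (ℕ.suc n)) ℕ.+ 1 ≡ 1 ℕ.+ ℕ.suc n ℕ.* x ℕ.* ℕ.suc (ℕ.suc n)
      lemma₂ = solve-∀

    -- inv 0F = 0F, which makes inv an involution of the whole of F.
    inv : F → F
    inv a with a ≟ 0F
    ... | yes _   = 0F
    ... | no  a≢0 = proj₁ (inverse-exists a≢0)

    *F-inverseˡ : ∀ {a} → a ≢ 0F → inv a *F a ≡ 1F
    *F-inverseˡ {a} a≢0 with a ≟ 0F
    ... | yes a≡0  = ⊥-elim (a≢0 a≡0)
    ... | no  a≢0′ = proj₂ (inverse-exists a≢0′)

    *F-inverseʳ : ∀ {a} → a ≢ 0F → a *F inv a ≡ 1F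
    *F-inverseʳ {a} a≢0 = trans (*F-comm a (inv a)) (*F-inverseˡ a≢0)

    *F-solve : ∀ {a x z} → a ≢ 0F → a *F x ≡ z → x ≡ inv a *F z
    *F-solve {a} {x} {z} a≢0 ax≡z = begin
      x                    ≡⟨ *F-identityˡ x ⟨
      1F *F x              ≡⟨ cong (_*F x) (*F-inverseˡ a≢0) ⟨
      (inv a *F a) *F x    ≡⟨ *F-assoc (inv a) a x ⟩
      inv a *F (a *F x)    ≡⟨ cong (inv a *F_) ax≡z ⟩
      inv a *F z           ∎

    *F-inverse-cancel : ∀ {a} z → a ≢ 0F → a *F (inv a *F z) ≡ z
    *F-inverse-cancel {a} z a≢0 =
      trans (sym (*F-assoc a (inv a) z)) (trans (cong (_*F z) (*F-inverseʳ a≢0)) (*F-identityˡ z))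

    inverse-unique : ∀ {a x} → a ≢ 0F → x *F a ≡ 1F → x ≡ inv a
    inverse-unique {a} {x} a≢0 xa≡1 = trans (*F-solve a≢0 (trans (*F-comm a x) xa≡1)) (*F-identityʳ (inv a))

    inv-≢0 : ∀ {a} → a ≢ 0F → inv a ≢ 0F
    inv-≢0 {a} a≢0 inv≡0 = 0F≢1F (trans (sym (cong (_*F a) inv≡0)) (*F-inverseˡ a≢0))

    inv-involutive : Involutive _≡_ inv
    inv-involutive a = involutive-at (a ≟ 0F)
      where
      involutive-at : Dec (a ≡ 0F) → inv (inv a) ≡ a
      involutive-at (yes a≡0) = subst (λ x → inv (inv x) ≡ x) (sym a≡0) refl
      involutive-at (no  a≢0) = sym (inverse-unique (inv-≢0 a≢0) (*F-inverseʳ a≢0))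

module GroupRing (n : ℕ) where
  open Field n
  open PrimeField n

  Factorisation : F → F → F → Set
  Factorisation z x y = x ≢ 0F × y ≢ 0F × x *F y ≡ z

  factorisation? : ∀ z x y → Dec (Factorisation z x y)
  factorisation? z x y = ¬? (x ≟ 0F) ×-dec ¬? (y ≟ 0F) ×-dec (x *F y ≟ z)

  product-term : ZG → ZG → F → F → F → ℤ
  product-term f g z x y = if does (factorisation? z x y) then f x * g y else 0ℤ

  *G-as-sum : ∀ f g z → (f *G g) z ≡ ∑[ x < p ] ∑[ y < p ] product-term f g z x y
  *G-as-sum f g z = trans (ΣFin≡sum p (λ x → ΣFin p (product-term f g z x)))
                          (sum-cong-≗ (λ x → ΣFin≡sum p (product-term f g z x)))

  *G-comm : ∀ f g z → (f *G g) z ≡ (g *G f) z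
  *G-comm f g z = begin
    (f *G g) z                                     ≡⟨ *G-as-sum f g z ⟩
    ∑[ x < p ] ∑[ y < p ] product-term f g z x y   ≡⟨ ∑-comm {p} {p} (product-term f g z) ⟩
    ∑[ y < p ] ∑[ x < p ] product-term f g z x y   ≡⟨ sum-cong-≗ (λ y → sum-cong-≗ (λ x → swap x y)) ⟩
    ∑[ y < p ] ∑[ x < p ] product-term g f z y x   ≡⟨ *G-as-sum g f z ⟨
    (g *G f) z                                     ∎
    where
    swap : ∀ x y → product-term f g z x y ≡ product-term g f z y x
    swap x y = swap-at (factorisation? z x y) (factorisation? z y x)
      where
      swap-at : (xy? : Dec (Factorisation z x y)) (yx? : Dec (Factorisation z y x)) →
                (if does xy? then f x * g y else 0ℤ) ≡ (if does yx? then g y * f x else 0ℤ)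
      swap-at (yes _) (yes _) = ℤP.*-comm (f x) (g y)
      swap-at (no  _) (no  _) = refl
      swap-at (yes (x≢0 , y≢0 , xy≡z)) (no ¬yx) = ⊥-elim (¬yx (y≢0 , x≢0 , trans (*F-comm y x) xy≡z))
      swap-at (no ¬xy) (yes (y≢0 , x≢0 , yx≡z)) = ⊥-elim (¬xy (x≢0 , y≢0 , trans (*F-comm x y) yx≡z))

  *G-linearˡ : ∀ c f₁ f₂ g z → ((λ w → c * f₁ w + f₂ w) *G g) z ≡ c * (f₁ *G g) z + (f₂ *G g) z
  *G-linearˡ c f₁ f₂ g z = begin
    (f *G g) z                                       ≡⟨ *G-as-sum f g z ⟩
    ∑[ x < p ] ∑[ y < p ] product-term f g z x y     ≡⟨ sum-cong-≗ (λ x → trans (sum-cong-≗ (split x)) (∑-linear c (t₁ x) (t₂ x))) ⟩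
    ∑[ x < p ] (c * sum (t₁ x) + sum (t₂ x))         ≡⟨ ∑-linear c (sum ∘ t₁) (sum ∘ t₂) ⟩
    c * ∑[ x < p ] sum (t₁ x) + ∑[ x < p ] sum (t₂ x) ≡⟨ cong₂ (λ a b → c * a + b) (*G-as-sum f₁ g z) (*G-as-sum f₂ g z) ⟨
    c * (f₁ *G g) z + (f₂ *G g) z                    ∎
    where
    f : ZG
    f w = c * f₁ w + f₂ w
    t₁ t₂ : F → F → ℤ
    t₁ = product-term f₁ g z
    t₂ = product-term f₂ g z
    split : ∀ x y → product-term f g z x y ≡ c * t₁ x y + t₂ x y
    split x y = if-linear (does (factorisation? z x y))
      where
      if-linear : ∀ b → (if b then f x * g y else 0ℤ) ≡ c * (if b then f₁ x * g y else 0ℤ) + (if b then f₂ x * g y else 0ℤ)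
      if-linear true  = trans (ℤP.*-distribʳ-+ (g y) (c * f₁ x) (f₂ x)) (cong (_+ f₂ x * g y) (ℤP.*-assoc c (f₁ x) (g y)))
      if-linear false = sym (trans (ℤP.+-identityʳ (c * 0ℤ)) (ℤP.*-zeroʳ c))

  *G-zeroˡ : ∀ g z → ((λ _ → 0ℤ) *G g) z ≡ 0ℤ
  *G-zeroˡ g z = trans (*G-as-sum (λ _ → 0ℤ) g z)
    (trans (sum-cong-≗ (λ x → trans (sum-cong-≗ (λ y → if-0 (does (factorisation? z x y)))) (sum-replicate-zero p)))
           (sum-replicate-zero p))
    where
    if-0 : ∀ b → (if b then 0ℤ else 0ℤ) ≡ 0ℤ
    if-0 true  = refl
    if-0 false = refl

  *G-congˡ : ∀ {f f'} → f ≈G f' → ∀ g z → (f *G g) z ≡ (f' *G g) z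
  *G-congˡ {f} {f'} f≈f' g z =
    trans (*G-as-sum f g z) (trans (sum-cong-≗ (λ x → sum-cong-≗ (λ y → summand x y))) (sym (*G-as-sum f' g z)))
    where
    summand : ∀ x y → product-term f g z x y ≡ product-term f' g z x y
    summand x y = summand-at (factorisation? z x y)
      where
      summand-at : (xy? : Dec (Factorisation z x y)) →
                   (if does xy? then f x * g y else 0ℤ) ≡ (if does xy? then f' x * g y else 0ℤ)
      summand-at (yes (x≢0 , _)) = cong (_* g y) (f≈f' x x≢0)
      summand-at (no  _)         = refl

  *G-cong : ∀ {f f' g g'} → f ≈G f' → g ≈G g' → ∀ z → (f *G g) z ≡ (f' *G g') z
  *G-cong {f} {f'} {g} {g'} f≈f' g≈g' z = begin
    (f *G g) z     ≡⟨ *G-congˡ f≈f' g z ⟩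
    (f' *G g) z    ≡⟨ *G-comm f' g z ⟩
    (g *G f') z    ≡⟨ *G-congˡ g≈g' f' z ⟩
    (g' *G f') z   ≡⟨ *G-comm g' f' z ⟩
    (f' *G g') z   ∎

  linComb-tabulate : ∀ {m} (e : Fin m → Subset × ℤ) z →
                     linComb (tabulate e) z ≡ ∑[ i < m ] (proj₂ (e i) * classSum (proj₁ (e i)) z)
  linComb-tabulate {ℕ.zero}  e z = refl
  linComb-tabulate {ℕ.suc m} e z = cong (_+_ (proj₂ (e zero) * classSum (proj₁ (e zero)) z)) (linComb-tabulate (e ∘ suc) z)

  module Convolution (p-prime : Prime p) where
    open Inverse p-prime

    *G-convolution : ∀ f g {z} → f 0F ≡ 0ℤ → z ≢ 0F → (f *G g) z ≡ ∑[ x < p ] (f x * g (inv x *F z))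
    *G-convolution f g {z} f0≡0 z≢0 = trans (*G-as-sum f g z) (sum-cong-≗ (λ x → row x (x ≟ 0F)))
      where
      row : ∀ x → Dec (x ≡ 0F) → ∑[ y < p ] product-term f g z x y ≡ f x * g (inv x *F z)
      row x (yes refl) = trans (sum-replicate-zero p) (sym (cong (_* g (inv 0F *F z)) f0≡0))
      row x (no  x≢0)  = trans (sum-single (product-term f g z x) (inv x *F z) off-diagonal) on-diagonal
        where
        quotient≢0 : inv x *F z ≢ 0F
        quotient≢0 e = z≢0 (trans (sym (*F-inverse-cancel z x≢0)) (trans (cong (x *F_) e) (*F-zeroʳ x)))
        off-diagonal : ∀ y → y ≢ inv x *F z → product-term f g z x y ≡ 0ℤ
        off-diagonal y y≢ = cong (λ b → if b then f x * g y else 0ℤ)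
          (dec-false (factorisation? z x y) (λ (_ , _ , xy≡z) → y≢ (*F-solve x≢0 xy≡z)))
        on-diagonal : product-term f g z x (inv x *F z) ≡ f x * g (inv x *F z)
        on-diagonal = cong (λ b → if b then f x * g (inv x *F z) else 0ℤ)
          (dec-true (factorisation? z x (inv x *F z)) (x≢0 , quotient≢0 , *F-inverse-cancel z x≢0))

module Configuration (n : ℕ) (p-prime : Prime (Field.p n)) (col : Field.Tri n → ℕ)
                     (cc : Field.IsTernaryCC n col) (agl : Field.AGL-Invariant n col) where
  open Field n
  open PrimeField n
  open Inverse p-prime
  open GroupRing n
  open Convolution p-prime
  open IsTernaryCC cc

  κ : F → ℕ
  κ v = col (0F , 1F , v)

  κ≡κ0⇒≡0 : ∀ {w} → κ w ≡ κ 0F → w ≡ 0F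
  κ≡κ0⇒≡0 {w} e = sym (C1 (0F , 1F , 0F) (0F , 1F , w) (sym e) zero (suc (suc zero)) refl)

  κ≡κ1⇒≡1 : ∀ {w} → κ w ≡ κ 1F → w ≡ 1F
  κ≡κ1⇒≡1 {w} e = sym (C1 (0F , 1F , 1F) (0F , 1F , w) (sym e) (suc zero) (suc (suc zero)) refl)

  ≢0-resp-κ : ∀ {u v} → u ≢ 0F → κ u ≡ κ v → v ≢ 0F
  ≢0-resp-κ u≢0 e v≡0 = u≢0 (κ≡κ0⇒≡0 (trans e (cong κ v≡0)))

  colour-scale : ∀ {a} y → a ≢ 0F → col (0F , a , a *F y) ≡ κ y
  colour-scale {a} y a≢0 = trans (cong col (sym scaled)) (agl a 0F a≢0 (0F , 1F , y))
    where
    scaled : mapTri (λ t → (a *F t) +F 0F) (0F , 1F , y) ≡ (0F , a , a *F y)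
    scaled = cong₂ _,_ (trans (+F-identityʳ _) (*F-zeroʳ a))
                       (cong₂ _,_ (trans (+F-identityʳ _) (*F-identityʳ a)) (+F-identityʳ _))

  colour-quotient : ∀ {a} z → a ≢ 0F → col (0F , a , z) ≡ κ (inv a *F z)
  colour-quotient {a} z a≢0 =
    trans (cong (λ t → col (0F , a , t)) (sym (*F-inverse-cancel z a≢0))) (colour-scale (inv a *F z) a≢0)

  colour-reflect : ∀ u → col (1F , 0F , reflect u) ≡ κ u
  colour-reflect u = trans (cong₂ (λ a b → col (a , b , reflect u)) (sym reflect-0) (sym reflect-1))
                           (agl -1F 1F -1F≢0 (0F , 1F , u))

  swap₁₂ swap₂₃ : Fin 3 → Fin 3
  swap₁₂ = λ { zero → suc zero ; (suc zero) → zero ; (suc (suc zero)) → suc (suc zero) }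
  swap₂₃ = λ { zero → zero ; (suc zero) → suc (suc zero) ; (suc (suc zero)) → suc zero }

  PreservesColour : (F → F) → Set
  PreservesColour φ = ∀ {u v} → κ u ≡ κ v → κ (φ u) ≡ κ (φ v)

  reflect-preservesColour : PreservesColour reflect
  reflect-preservesColour {u} {v} e =
    C2-⊆ swap₁₂ (1F , 0F , reflect u) (1F , 0F , reflect v) (trans (colour-reflect u) (trans e (sym (colour-reflect v))))

  colour-inverse : ∀ {a} → a ≢ 0F → col (0F , a , 1F) ≡ κ (inv a)
  colour-inverse {a} a≢0 = trans (colour-quotient 1F a≢0) (cong κ (*F-identityʳ (inv a)))

  inv-preservesColour : PreservesColour inv
  inv-preservesColour {u} {v} e = by-cases (u ≟ 0F)
    where
    by-cases : Dec (u ≡ 0F) → κ (inv u) ≡ κ (inv v)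
    by-cases (yes u≡0) = cong (κ ∘ inv) (trans u≡0 (sym (κ≡κ0⇒≡0 (trans (sym e) (cong κ u≡0)))))
    by-cases (no  u≢0) = begin
      κ (inv u)         ≡⟨ colour-inverse u≢0 ⟨
      col (0F , u , 1F) ≡⟨ C2-⊆ swap₂₃ (0F , 1F , u) (0F , 1F , v) e ⟩
      col (0F , v , 1F) ≡⟨ colour-inverse (≢0-resp-κ u≢0 e) ⟩
      κ (inv v)         ∎

  fibre01-refl : ∀ s → fibre01 col s s ≡ true
  fibre01-refl s = dec-true (κ s ℕ.≟ κ s) refl

  fibre-colour : ∀ {S s w} → S ≐ fibre01 col s → S w ≡ true → κ w ≡ κ s
  fibre-colour {S} {s} {w} S≐ Sw = dec-witness (κ w ℕ.≟ κ s) (trans (sym (S≐ w)) Sw)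

  fibre-singleton : ∀ {a} → (∀ {w} → κ w ≡ κ a → w ≡ a) → fibre01 col a ≐ singleton a
  fibre-singleton {a} rigid w = does-⇔ (mk⇔ rigid (cong κ)) (κ w ℕ.≟ κ a) (w ≟ a)

  InΠ-fibre : ∀ {s} → s ≢ 0F → InΠ col (fibre01 col s)
  InΠ-fibre {s} s≢0 = (s , λ _ → refl) , λ fibre≐0 → s≢0 (dec-witness (s ≟ 0F) (trans (sym (fibre≐0 s)) (fibre01-refl s)))

  InΠ⇒fibre : ∀ {S} → InΠ col S → ∃[ s ] (S ≐ fibre01 col s × s ≢ 0F)
  InΠ⇒fibre ((s , S≐) , S≢0) = s , S≐ , λ { refl → S≢0 (λ w → trans (S≐ w) (fibre-singleton κ≡κ0⇒≡0 w)) }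

  InΠ-resp-≐ : ∀ {S T} → S ≐ T → InΠ col T → InΠ col S
  InΠ-resp-≐ S≐T ((z , T≐) , T≢0) =
    (z , λ w → trans (S≐T w) (T≐ w)) , λ S≐0 → T≢0 (λ w → trans (sym (S≐T w)) (S≐0 w))

  InΠ⇒0∉ : ∀ {S} → InΠ col S → S 0F ≡ false
  InΠ⇒0∉ ΠS with InΠ⇒fibre ΠS
  ... | s , S≐ , s≢0 = ¬-not (λ S0 → s≢0 (κ≡κ0⇒≡0 (sym (fibre-colour S≐ S0))))

  InΠ-isPartitionOfUnits : IsPartitionOfUnits (InΠ col)
  InΠ-isPartitionOfUnits = units , nonempty , covering , disjoint
    where
    units : ∀ S → InΠ col S → ∀ w → S w ≡ true → w ≢ 0F
    units S ΠS w Sw refl = not-¬ (InΠ⇒0∉ ΠS) Sw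
    nonempty : ∀ S → InΠ col S → ∃[ w ] (S w ≡ true)
    nonempty S ΠS with InΠ⇒fibre ΠS
    ... | s , S≐ , _ = s , trans (S≐ s) (fibre01-refl s)
    covering : ∀ w → w ≢ 0F → ∃[ S ] (InΠ col S × S w ≡ true)
    covering w w≢0 = fibre01 col w , InΠ-fibre w≢0 , fibre01-refl w
    disjoint : ∀ S T w → InΠ col S → InΠ col T → S w ≡ true → T w ≡ true → S ≐ T
    disjoint S T w ΠS ΠT Sw Tw v with InΠ⇒fibre ΠS | InΠ⇒fibre ΠT
    ... | s , S≐ , _ | t , T≐ , _ =
      trans (S≐ v) (trans (cong (κ v ≡ᵇ_) (trans (sym (fibre-colour S≐ Sw)) (fibre-colour T≐ Tw))) (sym (T≐ v)))

  InΠ-singleton1 : InΠ col (singleton 1F)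
  InΠ-singleton1 = InΠ-resp-≐ (λ w → sym (fibre-singleton κ≡κ1⇒≡1 w)) (InΠ-fibre (λ ()))

  InΠ-∘-involution : ∀ (φ : F → F) → Involutive _≡_ φ → PreservesColour φ →
                     ∀ {X} → InΠ col X → X (φ 0F) ≡ false → InΠ col (X ∘ φ)
  InΠ-∘-involution φ involutive preserves {X} ΠX Xφ0 with InΠ⇒fibre ΠX
  ... | s , X≐ , _ = InΠ-resp-≐ X∘φ≐ (InΠ-fibre φs≢0)
    where
    X∘φ≐ : ∀ w → X (φ w) ≡ fibre01 col (φ s) w
    X∘φ≐ w = trans (X≐ (φ w)) (does-⇔ (mk⇔ to from) (κ (φ w) ℕ.≟ κ s) (κ w ℕ.≟ κ (φ s)))
      where
      to : κ (φ w) ≡ κ s → κ w ≡ κ (φ s)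
      to e = trans (cong κ (sym (involutive w))) (preserves e)
      from : κ w ≡ κ (φ s) → κ (φ w) ≡ κ s
      from e = trans (preserves e) (cong κ (involutive s))
    φs≢0 : φ s ≢ 0F
    φs≢0 φs≡0 = not-¬ Xφ0 (trans (cong X (trans (sym (cong φ φs≡0)) (involutive s))) (trans (X≐ s) (fibre01-refl s)))

  inverseSet≐ : ∀ S → S 0F ≡ false → inverseSet S ≐ (S ∘ inv)
  inverseSet≐ S S0 w = at w (w ≟ 0F)
    where
    at : ∀ w → Dec (w ≡ 0F) → inverseSet S w ≡ S (inv w)
    at w (yes refl) = trans (anyFin-false _ (λ x → trans (cong (S x ∧_) (no-inverse x)) (∧-zeroʳ (S x)))) (sym S0)
      where
      no-inverse : ∀ x → ((x *F 0F) == 1F) ≡ false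
      no-inverse x = dec-false (x *F 0F ≟ 1F) (0F≢1F ∘ trans (sym (*F-zeroʳ x)))
    at w (no  w≢0)  = anyFin-∧-unique S (λ x → (x *F w) == 1F) (inv w)
      (dec-true (inv w *F w ≟ 1F) (*F-inverseˡ w≢0))
      (λ x xw≡1 → inverse-unique w≢0 (dec-witness (x *F w ≟ 1F) xw≡1))

  oneMinus≐ : ∀ S → oneMinus S ≐ (S ∘ reflect)
  oneMinus≐ S w = anyFin-∧-unique S (λ x → w == (1F -F x)) (reflect w)
    (dec-true (w ≟ 1F -F reflect w) (trans (sym (reflect-involutive w)) (reflect≡1- (reflect w))))
    (λ x w≡1-x → trans (sym (reflect-involutive x))
                       (cong reflect (sym (trans (dec-witness (w ≟ 1F -F x) w≡1-x) (sym (reflect≡1- x))))))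

  InΠ-inverseSet : ∀ X → InΠ col X → InΠ col (inverseSet X)
  InΠ-inverseSet X ΠX = InΠ-resp-≐ (inverseSet≐ X (InΠ⇒0∉ ΠX))
    (InΠ-∘-involution inv inv-involutive inv-preservesColour ΠX (InΠ⇒0∉ ΠX))

  InΠ-oneMinus : ∀ X → InΠ col X → X 1F ≡ false → InΠ col (oneMinus X)
  InΠ-oneMinus X ΠX X1 = InΠ-resp-≐ (oneMinus≐ X)
    (InΠ-∘-involution reflect reflect-involutive reflect-preservesColour ΠX (trans (cong X reflect-0) X1))

  IsClassFunction : ZG → Set
  IsClassFunction h = ∀ {z z'} → z ≢ 0F → κ z ≡ κ z' → h z ≡ h z'

  IsClassFunction-resp : ∀ {f g} → (∀ z → f z ≡ g z) → IsClassFunction g → IsClassFunction f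
  IsClassFunction-resp f≗g class {z} {z'} z≢0 e = trans (f≗g z) (trans (class z≢0 e) (sym (f≗g z')))

  classSum-isClassFunction : ∀ {S} → InΠ col S → IsClassFunction (classSum S)
  classSum-isClassFunction ΠS {z} {z'} _ e with InΠ⇒fibre ΠS
  ... | s , S≐ , _ = cong ind (trans (S≐ z) (trans (cong (_≡ᵇ κ s) e) (sym (S≐ z'))))

  linComb-isClassFunction : ∀ {L} → All (InΠ col ∘ proj₁) L → IsClassFunction (linComb L)
  linComb-isClassFunction []         _   _ = refl
  linComb-isClassFunction {(S , c) ∷ _} (ΠS ∷ ΠL) z≢0 e =
    cong₂ (λ a b → c * a + b) (classSum-isClassFunction ΠS z≢0 e) (linComb-isClassFunction ΠL z≢0 e)

  span⇒isClassFunction : ∀ {h} → InSpan (InΠ col) h → IsClassFunction h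
  span⇒isClassFunction (L , ΠL , h≈L) {z} {z'} z≢0 e =
    trans (h≈L z z≢0) (trans (linComb-isClassFunction ΠL z≢0 e) (sym (h≈L z' (≢0-resp-κ z≢0 e))))

  -- Each fibre is listed once, through its first element; the fibre {0} has index zero and is dropped.
  isClassFunction⇒span : ∀ {h} → IsClassFunction h → InSpan (InΠ col) h
  isClassFunction⇒span {h} class = tabulate entry , tabulate⁺ {f = entry} (λ v → InΠ-fibre {suc v} (λ ())) , expansion
    where
    coefficient : F → ℤ
    coefficient w = h w * ind (isFirst κ w)
    entry : Fin (ℕ.suc n) → Subset × ℤ
    entry v = fibre01 col (suc v) , coefficient (suc v)
    expansion : ∀ z → z ≢ 0F → h z ≡ linComb (tabulate entry) z
    expansion z z≢0 = begin
      h z                                         ≡⟨ fibre-expansion κ h z constant ⟩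
      coefficient 0F * ind (κ z ≡ᵇ κ 0F) + rest   ≡⟨ cong (_+ rest) vanishes ⟩
      0ℤ + rest                                   ≡⟨ ℤP.+-identityˡ rest ⟩
      rest                                        ≡⟨ linComb-tabulate entry z ⟨
      linComb (tabulate entry) z                  ∎
      where
      rest : ℤ
      rest = ∑[ v < ℕ.suc n ] (coefficient (suc v) * ind (κ z ≡ᵇ κ (suc v)))
      constant : ∀ {w} → κ w ≡ κ z → h w ≡ h z
      constant e = class (≢0-resp-κ z≢0 (sym e)) e
      vanishes : coefficient 0F * ind (κ z ≡ᵇ κ 0F) ≡ 0ℤ
      vanishes = trans (cong (λ b → coefficient 0F * ind b) (dec-false (κ z ℕ.≟ κ 0F) (z≢0 ∘ κ≡κ0⇒≡0)))
                       (ℤP.*-zeroʳ (coefficient 0F))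

  linComb-*G-isClassFunction : ∀ {g L} → (∀ {S} → InΠ col S → IsClassFunction (classSum S *G g)) →
                               All (InΠ col ∘ proj₁) L → IsClassFunction (linComb L *G g)
  linComb-*G-isClassFunction {g} base [] {z} {z'} _ _ = trans (*G-zeroˡ g z) (sym (*G-zeroˡ g z'))
  linComb-*G-isClassFunction {g} {(S , c) ∷ L} base (ΠS ∷ ΠL) {z} {z'} z≢0 e = begin
    (linComb ((S , c) ∷ L) *G g) z                   ≡⟨ *G-linearˡ c (classSum S) (linComb L) g z ⟩
    c * (classSum S *G g) z + (linComb L *G g) z     ≡⟨ cong₂ (λ a b → c * a + b) (base {S} ΠS z≢0 e)
                                                                                  (linComb-*G-isClassFunction {g} {L} base ΠL z≢0 e) ⟩
    c * (classSum S *G g) z' + (linComb L *G g) z'   ≡⟨ *G-linearˡ c (classSum S) (linComb L) g z' ⟨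
    (linComb ((S , c) ∷ L) *G g) z'                  ∎

  -- α is in the fibre of s and, by colour-quotient, α⁻¹ z in that of t; stated through triples so that (C3) applies.
  leftFactor : F → F → F → F → Bool
  leftFactor s t z α = (col (0F , α , z) ≡ᵇ κ t) ∧ (κ α ≡ᵇ κ s)

  -- (C3) fixes the count for each colour of (α , 1 , z); summing over these colours removes that condition.
  leftFactor-count-invariant : ∀ s t {z z'} → κ z ≡ κ z' → ℤ.+ count p (leftFactor s t z) ≡ ℤ.+ count p (leftFactor s t z')
  leftFactor-count-invariant s t {z} {z'} e = begin
    ℤ.+ count p (leftFactor s t z)
      ≡⟨ count-by-colour (colour₁ z) (leftFactor s t z) (λ α → ℕ.m⊔n<o⇒m<o _ (colour₁ z' α) (<N α)) ⟨
    ∑[ c < N ] (ℤ.+ count p (λ α → (colour₁ z α ≡ᵇ toℕ c) ∧ leftFactor s t z α))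
      ≡⟨ sum-cong-≗ {N} (λ c → cong ℤ.+_ (C3 (toℕ c) (κ t) (κ s) (0F , 1F , z) (0F , 1F , z') e)) ⟩
    ∑[ c < N ] (ℤ.+ count p (λ α → (colour₁ z' α ≡ᵇ toℕ c) ∧ leftFactor s t z' α))
      ≡⟨ count-by-colour (colour₁ z') (leftFactor s t z') (λ α → ℕ.m⊔n<o⇒n<o (colour₁ z α) _ (<N α)) ⟩
    ℤ.+ count p (leftFactor s t z')
      ∎
    where
    colour₁ : F → F → ℕ
    colour₁ z α = col (α , 1F , z)
    bound : ∃[ N ] (∀ α → colour₁ z α ℕ.⊔ colour₁ z' α ℕ.< N)
    bound = bounded (λ α → colour₁ z α ℕ.⊔ colour₁ z' α)
    N : ℕ
    N = proj₁ bound
    <N : ∀ α → colour₁ z α ℕ.⊔ colour₁ z' α ℕ.< N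
    <N = proj₂ bound

  classSum-*G-classSum : ∀ {S T s t} → S ≐ fibre01 col s → s ≢ 0F → T ≐ fibre01 col t →
                         ∀ {z} → z ≢ 0F → (classSum S *G classSum T) z ≡ ℤ.+ count p (leftFactor s t z)
  classSum-*G-classSum {S} {T} {s} {t} S≐ s≢0 T≐ {z} z≢0 = begin
    (classSum S *G classSum T) z                          ≡⟨ *G-convolution (classSum S) (classSum T) (cong ind S0) z≢0 ⟩
    ∑[ α < p ] (classSum S α * classSum T (inv α *F z))   ≡⟨ sum-cong-≗ (λ α → trans (ind-∧ (S α) _) (cong ind (in-leftFactor α))) ⟩
    ∑[ α < p ] ind (leftFactor s t z α)                   ≡⟨ count≡sum p (leftFactor s t z) ⟨
    ℤ.+ count p (leftFactor s t z)                        ∎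
    where
    S0 : S 0F ≡ false
    S0 = trans (S≐ 0F) (dec-false (κ 0F ℕ.≟ κ s) (s≢0 ∘ κ≡κ0⇒≡0 ∘ sym))
    in-leftFactor : ∀ α → S α ∧ T (inv α *F z) ≡ leftFactor s t z α
    in-leftFactor α = begin
      S α ∧ T (inv α *F z)                                 ≡⟨ cong₂ _∧_ (S≐ α) (T≐ (inv α *F z)) ⟩
      (κ α ≡ᵇ κ s) ∧ (κ (inv α *F z) ≡ᵇ κ t)               ≡⟨ ∧-comm (κ α ≡ᵇ κ s) _ ⟩
      (κ (inv α *F z) ≡ᵇ κ t) ∧ (κ α ≡ᵇ κ s)               ≡⟨ ∧-congˡ-if (κ α ≡ᵇ κ s) (λ α∈s →
                                                                cong (_≡ᵇ κ t) (sym (colour-quotient z (α≢0 α∈s)))) ⟩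
      leftFactor s t z α                                   ∎
      where
      α≢0 : (κ α ≡ᵇ κ s) ≡ true → α ≢ 0F
      α≢0 α∈s = ≢0-resp-κ s≢0 (sym (dec-witness (κ α ℕ.≟ κ s) α∈s))

  classSum-*G-isClassFunction : ∀ {S T} → InΠ col S → InΠ col T → IsClassFunction (classSum S *G classSum T)
  classSum-*G-isClassFunction {S} {T} ΠS ΠT {z} {z'} z≢0 e with InΠ⇒fibre ΠS | InΠ⇒fibre ΠT
  ... | s , S≐ , s≢0 | t , T≐ , _ = begin
    (classSum S *G classSum T) z     ≡⟨ classSum-*G-classSum S≐ s≢0 T≐ z≢0 ⟩
    ℤ.+ count p (leftFactor s t z)   ≡⟨ leftFactor-count-invariant s t e ⟩
    ℤ.+ count p (leftFactor s t z')  ≡⟨ classSum-*G-classSum S≐ s≢0 T≐ (≢0-resp-κ z≢0 e) ⟨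
    (classSum S *G classSum T) z'    ∎

  span-*G : ∀ f g → InSpan (InΠ col) f → InSpan (InΠ col) g → InSpan (InΠ col) (f *G g)
  span-*G f g (L , ΠL , f≈L) (L' , ΠL' , g≈L') =
    isClassFunction⇒span (IsClassFunction-resp (*G-cong f≈L g≈L') products)
    where
    products : IsClassFunction (linComb L *G linComb L')
    products = linComb-*G-isClassFunction {linComb L'}
      (λ {S} ΠS → IsClassFunction-resp (*G-comm (classSum S) (linComb L'))
        (linComb-*G-isClassFunction {classSum S}
          (λ {T} ΠT → IsClassFunction-resp (*G-comm (classSum T) (classSum S)) (classSum-*G-isClassFunction ΠS ΠT))
          ΠL'))
      ΠL

  InΠ-spanIsSubring : SpanIsSubring (InΠ col)
  InΠ-spanIsSubring = one , plus , negate , span-*G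
    where
    one : InSpan (InΠ col) oneG
    one = (singleton 1F , 1ℤ) ∷ [] , InΠ-singleton1 ∷ [] , λ z _ → sym (trans (ℤP.+-identityʳ _) (ℤP.*-identityˡ _))
    plus : ∀ f g → InSpan (InΠ col) f → InSpan (InΠ col) g → InSpan (InΠ col) (f +G g)
    plus f g f∈ g∈ = isClassFunction⇒span
      (λ z≢0 e → cong₂ _+_ (span⇒isClassFunction f∈ z≢0 e) (span⇒isClassFunction g∈ z≢0 e))
    negate : ∀ f → InSpan (InΠ col) f → InSpan (InΠ col) (-G f)
    negate f f∈ = isClassFunction⇒span (λ z≢0 e → cong -_ (span⇒isClassFunction f∈ z≢0 e))

lemma5p2 : (n : ℕ) → Prime (Field.p n) →
           (col : Field.Tri n → ℕ) → Field.IsTernaryCC n col → Field.AGL-Invariant n col →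
           Field.IsSchurPartition n (Field.InΠ n col)
           × (∀ X → Field.InΠ n col X → X (Field.1F n) ≡ false →
                Field.InΠ n col (Field.oneMinus n X))
lemma5p2 n p-prime col cc agl =
  (InΠ-isPartitionOfUnits , InΠ-singleton1 , InΠ-inverseSet , InΠ-spanIsSubring) , InΠ-oneMinus
  where open Configuration n p-prime col cc agl
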